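{- In the setting of the context, suppose $p_{2m+1}\ge p_1-p_m$ and $C_m^{LPT'}=p_{2m+1}+p_m+p_{2m}>C_m^*$. Then every optimal schedule has makespan $C_m^*\ge p_{m-1}+p_m$.
   Context: Problem $P_m\|C_{max}$ with $m\ge3$ identical machines and $n=2m+1$ jobs with processing times $p_1\ge p_2\ge\dots\ge p_{2m+1}\ge0$; the makespan is the maximum machine load and $C_m^*$ is the optimal makespan. LPT assigns jobs one at a time in order $1,\dots,n$ to a machine with currently smallest load. It is assumed that, in the LPT schedule, for each $i=1,\dots,m$ jobs $i$ and $2m+1-i$ are assigned to the same machine $M_i$ before job $2m+1$ is assigned, and that job $2m+1$ is the critical job (the last job on a machine whose load equals the LPT makespan). $LPT'$ is the schedule obtained by first placing job $2m+1$ alone on machine $M_1$ and then assigning jobs $1,2,\dots,2m$ in this order, each to a machine with currently smallest load; $C_m^{LPT'}$ is its makespan.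
   Formalization: The processing times $p_1\ge p_2\ge\dots\ge p_{2m+1}\ge0$ are rational numbers, so all machine loads and makespans are rational as well. -}

module Defs where

open import Data.Bool using (Bool; true; false; if_then_else_; _∧_; _∨_)
open import Data.Nat using (ℕ; zero; suc; _*_; _<ᵇ_; _≡ᵇ_)
import Data.Nat as ℕ
open import Data.Fin using (Fin)
import Data.Fin as Fin
open import Data.Rational using (ℚ; 0ℚ; _+_; _⊔_; _≤_)
open import Relation.Nullary using (does)

-- number of jobs n = 2m+1; jobs are numbered 1..n (as in the paper)
jobs : ℕ → ℕ
jobs m = 2 * m ℕ.+ 1

-- processing times: p j for job j (only j = 1..n matter)
-- a schedule assigns each job to one of the m machines
Schedule : ℕ → Set
Schedule m = ℕ → Fin m

sumTo : ℕ → (ℕ → ℚ) → ℚ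
sumTo zero    f = 0ℚ
sumTo (suc k) f = sumTo k f + f (suc k)

maxFin : (m : ℕ) → (Fin m → ℚ) → ℚ
maxFin zero    f = 0ℚ
maxFin (suc m) f = f Fin.zero ⊔ maxFin m (λ k → f (Fin.suc k))

loadOf : (m : ℕ) → (ℕ → ℚ) → Schedule m → (ℕ → Bool) → Fin m → ℚ
loadOf m p σ S k = sumTo (jobs m)
  (λ j → if S j ∧ does (σ j Fin.≟ k) then p j else 0ℚ)

load : (m : ℕ) → (ℕ → ℚ) → Schedule m → Fin m → ℚ
load m p σ k = loadOf m p σ (λ _ → true) k

makespan : (m : ℕ) → (ℕ → ℚ) → Schedule m → ℚ
makespan m p σ = maxFin m (load m p σ)

IsOptimal : (m : ℕ) → (ℕ → ℚ) → Schedule m → Set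
IsOptimal m p σ = (τ : Schedule m) → makespan m p σ ≤ makespan m p τ

-- list scheduling w.r.t. a precedence "before j i" (= job i is assigned before job j):
-- every job j is put on a machine whose current load (jobs assigned before j) is smallest
IsListSchedule : (m : ℕ) → (ℕ → ℚ) → (ℕ → ℕ → Bool) → Schedule m → Set
IsListSchedule m p before σ =
  (j : ℕ) → 1 ℕ.≤ j → j ℕ.≤ jobs m → (k : Fin m) →
  loadOf m p σ (before j) (σ j) ≤ loadOf m p σ (before j) k

IsLPT : (m : ℕ) → (ℕ → ℚ) → Schedule m → Set
IsLPT m p σ = IsListSchedule m p (λ j i → i <ᵇ j) σ

-- LPT': job n = 2m+1 first (alone on an empty machine), then jobs 1, 2, ..., 2m in order
IsLPT' : (m : ℕ) → (ℕ → ℚ) → Schedule m → Set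
IsLPT' m p σ = IsListSchedule m p
  (λ j i → if j ≡ᵇ jobs m then false else ((i <ᵇ j) ∨ (i ≡ᵇ jobs m))) σ

-- Jobs m+1, …, 2m+1 are m+1 jobs on m machines, so two of them, a < b, share a
-- machine. Were a job i ≤ m also on that machine, its load would be at least
-- p_m + p_2m + p_{2m+1}, the makespan of LPT', which exceeds C*_m. Hence in an
-- optimal schedule the m jobs 1, …, m avoid that machine, so two of them, u < v,
-- share one of the other m − 1 machines, and C*_m ≥ p_u + p_v ≥ p_{m−1} + p_m.
module Submission where

open import Defs
open import Data.Nat using (ℕ; _∸_; _*_)
import Data.Nat as ℕ
open import Data.Rational using (ℚ; 0ℚ; _+_; _-_; _≤_; _<_)
open import Relation.Binary.PropositionalEquality using (_≡_)

open import Data.Bool using (true; false; if_then_else_)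
open import Data.Empty using (⊥-elim)
open import Data.Fin using (Fin; toℕ; punchOut)
import Data.Fin as Fin
import Data.Fin.Properties as Fin
import Data.Nat.Properties as ℕ
open import Data.Nat.Tactic.RingSolver using (solve-∀)
open import Data.Product using (∃₂; _×_; _,_)
import Data.Rational.Properties as ℚ
open import Data.Sum using (_⊎_; inj₁; inj₂; [_,_]′)
open import Function using (_∘_)
open import Relation.Binary.PropositionalEquality using (refl; sym; trans; cong₂; subst; _≢_)
open import Relation.Nullary using (does; yes; no)
open import Relation.Nullary.Negation using (contradiction)

p≤p+q : ∀ p q → 0ℚ ≤ q → p ≤ p + q
p≤p+q p q 0≤q = ℚ.≤-trans (ℚ.≤-reflexive (sym (ℚ.+-identityʳ p))) (ℚ.+-monoʳ-≤ p 0≤q)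

antitone-from-steps : ∀ (f : ℕ → ℚ) N →
  (∀ j → 1 ℕ.≤ j → j ℕ.< N → f (ℕ.suc j) ≤ f j) →
  ∀ {i j} → 1 ℕ.≤ i → i ℕ.≤ j → j ℕ.≤ N → f j ≤ f i
antitone-from-steps f N step {i} {j} 1≤i i≤j j≤N with ℕ.m≤n⇒m<n∨m≡n i≤j
... | inj₂ refl = ℚ.≤-refl
... | inj₁ (ℕ.s≤s i≤j′) =
  ℚ.≤-trans (step _ (ℕ.≤-trans 1≤i i≤j′) j≤N)
            (antitone-from-steps f N step 1≤i i≤j′ (ℕ.<⇒≤ j≤N))

maxFin-upper : ∀ m (f : Fin m → ℚ) k → f k ≤ maxFin m f
maxFin-upper (ℕ.suc m) f Fin.zero    = ℚ.p≤p⊔q _ _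
maxFin-upper (ℕ.suc m) f (Fin.suc k) =
  ℚ.≤-trans (maxFin-upper m (λ k → f (Fin.suc k)) k) (ℚ.p≤q⊔p (f Fin.zero) _)

NonNegOn : ℕ → (ℕ → ℚ) → Set
NonNegOn n f = ∀ j → 1 ℕ.≤ j → j ℕ.≤ n → 0ℚ ≤ f j

module _ {f : ℕ → ℚ} where

  NonNegOn-≤ : ∀ {k n} → k ℕ.≤ n → NonNegOn n f → NonNegOn k f
  NonNegOn-≤ k≤n nonneg j 1≤j j≤k = nonneg j 1≤j (ℕ.≤-trans j≤k k≤n)

  sumTo-mono-≤ : ∀ {k n} → k ℕ.≤ n → NonNegOn n f → sumTo k f ≤ sumTo n f
  sumTo-mono-≤ {n = ℕ.zero}  ℕ.z≤n _ = ℚ.≤-refl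
  sumTo-mono-≤ {n = ℕ.suc n} k≤n nonneg with ℕ.m≤n⇒m<n∨m≡n k≤n
  ... | inj₂ refl = ℚ.≤-refl
  ... | inj₁ (ℕ.s≤s k≤n′) =
    ℚ.≤-trans (sumTo-mono-≤ k≤n′ (NonNegOn-≤ (ℕ.n≤1+n n) nonneg))
              (p≤p+q _ _ (nonneg (ℕ.suc n) (ℕ.s≤s ℕ.z≤n) ℕ.≤-refl))

  sumTo-+-≤ : ∀ {k j n} → k ℕ.< j → j ℕ.≤ n → NonNegOn n f →
              sumTo k f + f j ≤ sumTo n f
  sumTo-+-≤ {j = ℕ.suc j} (ℕ.s≤s k≤j) j≤n nonneg =
    ℚ.≤-trans (ℚ.+-monoˡ-≤ (f (ℕ.suc j)) (sumTo-mono-≤ k≤j (NonNegOn-≤ j≤n′ nonneg)))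
              (sumTo-mono-≤ j≤n nonneg)
    where j≤n′ = ℕ.<⇒≤ j≤n

  pair≤sumTo : ∀ {a b n} → 1 ℕ.≤ a → a ℕ.< b → b ℕ.≤ n → NonNegOn n f →
               f a + f b ≤ sumTo n f
  pair≤sumTo {a} {b} {n} 1≤a a<b b≤n nonneg = begin
    f a + f b              ≡⟨ cong₂ _+_ (sym (ℚ.+-identityˡ (f a))) refl ⟩
    sumTo 0 f + f a + f b  ≤⟨ ℚ.+-monoˡ-≤ (f b) (sumTo-+-≤ 1≤a ℕ.≤-refl (NonNegOn-≤ a≤n nonneg)) ⟩
    sumTo a f + f b        ≤⟨ sumTo-+-≤ a<b b≤n nonneg ⟩
    sumTo n f              ∎
    where
    open ℚ.≤-Reasoning
    a≤n = ℕ.<⇒≤ (ℕ.<-≤-trans a<b b≤n)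

  triple≤sumTo : ∀ {a b c n} → 1 ℕ.≤ a → a ℕ.< b → b ℕ.< c → c ℕ.≤ n → NonNegOn n f →
                 f a + f b + f c ≤ sumTo n f
  triple≤sumTo {a} {b} {c} {n} 1≤a a<b b<c c≤n nonneg = begin
    f a + f b + f c  ≤⟨ ℚ.+-monoˡ-≤ (f c) (pair≤sumTo 1≤a a<b ℕ.≤-refl (NonNegOn-≤ b≤n nonneg)) ⟩
    sumTo b f + f c  ≤⟨ sumTo-+-≤ b<c c≤n nonneg ⟩
    sumTo n f        ∎
    where
    open ℚ.≤-Reasoning
    b≤n = ℕ.<⇒≤ (ℕ.<-≤-trans b<c c≤n)

pigeonhole-avoiding : ∀ {n r} (k : Fin (ℕ.suc n)) (f : Fin r → Fin (ℕ.suc n)) →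
  n ℕ.< r → (∀ z → f z ≢ k) → ∃₂ λ i j → i Fin.< j × f i ≡ f j
pigeonhole-avoiding k f n<r avoids =
  let i , j , i<j , eq = Fin.pigeonhole n<r (λ z → punchOut (k≢ z))
  in  i , j , i<j , Fin.punchOut-injective (k≢ i) (k≢ j) eq
  where
  k≢ : ∀ z → k ≢ f z
  k≢ z k≡ = avoids z (sym k≡)

module MachineLoad (m : ℕ) (p : ℕ → ℚ) (nonneg : NonNegOn (jobs m) p)
                   (σ : Schedule m) (k : Fin m) where

  private
    onMachine : ℕ → ℚ
    onMachine j = if does (σ j Fin.≟ k) then p j else 0ℚ

    onMachine-nonneg : NonNegOn (jobs m) onMachine
    onMachine-nonneg j 1≤j j≤n with does (σ j Fin.≟ k)
    ... | true  = nonneg j 1≤j j≤n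
    ... | false = ℚ.≤-refl

  onMachine-on : ∀ {j} → σ j ≡ k → onMachine j ≡ p j
  onMachine-on {j} σj≡k with σ j Fin.≟ k
  ... | yes _   = refl
  ... | no σj≢k = contradiction σj≡k σj≢k

  load≤makespan : load m p σ k ≤ makespan m p σ
  load≤makespan = maxFin-upper m (load m p σ) k

  pair≤makespan : ∀ {a b} → 1 ℕ.≤ a → a ℕ.< b → b ℕ.≤ jobs m →
                  σ a ≡ k → σ b ≡ k → p a + p b ≤ makespan m p σ
  pair≤makespan 1≤a a<b b≤n σa≡k σb≡k = ℚ.≤-trans
    (ℚ.≤-reflexive (sym (cong₂ _+_ (onMachine-on σa≡k) (onMachine-on σb≡k))))
    (ℚ.≤-trans (pair≤sumTo 1≤a a<b b≤n onMachine-nonneg) load≤makespan)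

  triple≤makespan : ∀ {a b c} → 1 ℕ.≤ a → a ℕ.< b → b ℕ.< c → c ℕ.≤ jobs m →
                    σ a ≡ k → σ b ≡ k → σ c ≡ k → p a + p b + p c ≤ makespan m p σ
  triple≤makespan 1≤a a<b b<c c≤n σa≡k σb≡k σc≡k = ℚ.≤-trans
    (ℚ.≤-reflexive (sym (cong₂ _+_ (cong₂ _+_ (onMachine-on σa≡k) (onMachine-on σb≡k))
                                   (onMachine-on σc≡k))))
    (ℚ.≤-trans (triple≤sumTo 1≤a a<b b<c c≤n onMachine-nonneg) load≤makespan)

record EarlyJobJoinsLatePair (m : ℕ) (σ : Schedule m) : Set where
  field
    {i a b} : ℕ
    1≤i     : 1 ℕ.≤ i
    i≤m     : i ℕ.≤ m
    m<a     : m ℕ.< a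
    a<b     : a ℕ.< b
    b≤jobs  : b ℕ.≤ jobs m
    σa≡σi   : σ a ≡ σ i
    σb≡σi   : σ b ≡ σ i

record EarlyPair (m : ℕ) (σ : Schedule m) : Set where
  field
    {u v} : ℕ
    1≤u   : 1 ℕ.≤ u
    u<v   : u ℕ.< v
    v≤m   : v ℕ.≤ m
    σu≡σv : σ u ≡ σ v

suc-m+m≡jobs : ∀ m → ℕ.suc m ℕ.+ m ≡ 2 * m ℕ.+ 1
suc-m+m≡jobs = solve-∀

module _ {n : ℕ} where
  private
    m : ℕ
    m = ℕ.suc n

    early : Fin m → ℕ
    early z = ℕ.suc (toℕ z)

    late : Fin (ℕ.suc m) → ℕ
    late x = ℕ.suc m ℕ.+ toℕ x

  early-joins-late-pair-or-early-pair : (σ : Schedule m) →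
    EarlyJobJoinsLatePair m σ ⊎ EarlyPair m σ
  early-joins-late-pair-or-early-pair σ
    with x , y , x<y , σx≡σy ← Fin.pigeonhole (ℕ.n<1+n m) (σ ∘ late)
    with Fin.any? (λ z → σ (early z) Fin.≟ σ (late x))
  ... | yes (z , σz≡σx) = inj₁ record
    { 1≤i   = ℕ.s≤s ℕ.z≤n
    ; i≤m   = Fin.toℕ<n z
    ; m<a   = ℕ.s≤s (ℕ.m≤m+n m (toℕ x))
    ; a<b   = ℕ.+-monoʳ-< (ℕ.suc m) x<y
    ; b≤jobs = late≤jobs y
    ; σa≡σi = sym σz≡σx
    ; σb≡σi = trans (sym σx≡σy) (sym σz≡σx)
    }
    where
    late≤jobs : ∀ y → late y ℕ.≤ jobs m
    late≤jobs y = ℕ.≤-trans (ℕ.+-monoʳ-≤ (ℕ.suc m) (ℕ.≤-pred (Fin.toℕ<n y)))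
                            (ℕ.≤-reflexive (suc-m+m≡jobs m))
  ... | no avoids
    with u , v , u<v , σu≡σv ← pigeonhole-avoiding (σ (late x)) (σ ∘ early) (ℕ.n<1+n n)
                                                    (λ z σz≡ → avoids (z , σz≡))
    = inj₂ record
    { 1≤u   = ℕ.s≤s ℕ.z≤n
    ; u<v   = ℕ.s≤s u<v
    ; v≤m   = Fin.toℕ<n v
    ; σu≡σv = σu≡σv
    }

module ScheduleBounds (m : ℕ) (p : ℕ → ℚ)
  (step : ∀ j → 1 ℕ.≤ j → j ℕ.< jobs m → p (ℕ.suc j) ≤ p j)
  (p-last≥0 : 0ℚ ≤ p (jobs m)) (σ : Schedule m) where

  private
    antitone : ∀ {i j} → 1 ℕ.≤ i → i ℕ.≤ j → j ℕ.≤ jobs m → p j ≤ p i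
    antitone = antitone-from-steps p (jobs m) step

    nonneg : NonNegOn (jobs m) p
    nonneg j 1≤j j≤n = ℚ.≤-trans p-last≥0 (antitone 1≤j j≤n ℕ.≤-refl)

    m≤jobs : m ℕ.≤ jobs m
    m≤jobs = ℕ.≤-trans (ℕ.m≤m+n m (m ℕ.+ 0)) (ℕ.m≤m+n (2 * m) 1)

  early-joins-late-pair-bound : EarlyJobJoinsLatePair m σ →
    p (jobs m) + p m + p (2 * m) ≤ makespan m p σ
  early-joins-late-pair-bound c = begin
    p (jobs m) + p m + p (2 * m)  ≡⟨ rotate (p (jobs m)) (p m) (p (2 * m)) ⟩
    p m + p (2 * m) + p (jobs m)  ≤⟨ ℚ.+-mono-≤ (ℚ.+-mono-≤ (antitone 1≤i i≤m m≤jobs)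
                                                           (antitone 1≤a a≤2m (ℕ.m≤m+n (2 * m) 1)))
                                               (antitone 1≤b b≤jobs ℕ.≤-refl) ⟩
    p i + p a + p b               ≤⟨ triple≤makespan 1≤i i<a a<b b≤jobs refl σa≡σi σb≡σi ⟩
    makespan m p σ                ∎
    where
    open EarlyJobJoinsLatePair c
    open MachineLoad m p nonneg σ (σ i)
    open ℚ.≤-Reasoning
    rotate : ∀ x y z → x + y + z ≡ y + z + x
    rotate x y z = trans (ℚ.+-assoc x y z) (ℚ.+-comm x (y + z))
    i<a = ℕ.≤-<-trans i≤m m<a
    1≤a = ℕ.≤-trans 1≤i (ℕ.<⇒≤ i<a)
    1≤b = ℕ.≤-trans 1≤a (ℕ.<⇒≤ a<b)
    a≤2m = ℕ.≤-pred (ℕ.≤-trans a<b (ℕ.≤-trans b≤jobs (ℕ.≤-reflexive (ℕ.+-comm (2 * m) 1))))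

  early-pair-bound : EarlyPair m σ → p (m ∸ 1) + p m ≤ makespan m p σ
  early-pair-bound e = begin
    p (m ∸ 1) + p m  ≤⟨ ℚ.+-mono-≤ (antitone 1≤u u≤m∸1 (ℕ.≤-trans (ℕ.m∸n≤m m 1) m≤jobs))
                                   (antitone 1≤v v≤m m≤jobs) ⟩
    p u + p v        ≤⟨ pair≤makespan 1≤u u<v (ℕ.≤-trans v≤m m≤jobs) σu≡σv refl ⟩
    makespan m p σ   ∎
    where
    open EarlyPair e
    open MachineLoad m p nonneg σ (σ v)
    open ℚ.≤-Reasoning
    u≤m∸1 = ℕ.∸-monoˡ-≤ 1 (ℕ.<-≤-trans u<v v≤m)
    1≤v = ℕ.≤-trans 1≤u (ℕ.<⇒≤ u<v)

proposition10 : (m : ℕ) → 3 ℕ.≤ m →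
    (p : ℕ → ℚ) →
    ((j : ℕ) → 1 ℕ.≤ j → j ℕ.< jobs m → p (ℕ.suc j) ≤ p j) →
    0ℚ ≤ p (jobs m) →
    (σL : Schedule m) → IsLPT m p σL →
    ((i : ℕ) → 1 ℕ.≤ i → i ℕ.≤ m → σL i ≡ σL (jobs m ∸ i)) →
    load m p σL (σL (jobs m)) ≡ makespan m p σL →
    p 1 - p m ≤ p (jobs m) →
    (τ : Schedule m) → IsLPT' m p τ →
    makespan m p τ ≡ p (jobs m) + p m + p (2 * m) →
    (σ : Schedule m) → IsOptimal m p σ →
    makespan m p σ < makespan m p τ →
    p (m ∸ 1) + p m ≤ makespan m p σ
proposition10 m@(ℕ.suc _) _ p step p-last≥0 _ _ _ _ _ τ _ τ≡LPT'-bound σ _ σ<τ =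
  [ (λ c → ⊥-elim (ℚ.<-irrefl refl
             (ℚ.≤-<-trans (early-joins-late-pair-bound c) σ<LPT'-bound)))
  , early-pair-bound
  ]′ (early-joins-late-pair-or-early-pair σ)
  where
  open ScheduleBounds m p step p-last≥0 σ
  σ<LPT'-bound = subst (makespan m p σ <_) τ≡LPT'-bound σ<τ
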